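{- Let $G$ be an edge-magic $(p,q)$-graph, let $n\ge1$, let $\overrightarrow{G}$ be any orientation of $G$ and $\overrightarrow{K}_{1,n}^l$ any orientation of $K_{1,n}^l$. Let $\alpha$ and $\beta$ be the smallest and the biggest valences of edge-magic labelings of $G$, respectively. If $\beta-\alpha<(\alpha-(p+q+2))n$, then $|\tau_{\overrightarrow{G}\otimes\overrightarrow{K}_{1,n}^l}|\ge (n+3)|\tau_{G}|$.
   Context: Graphs may have loops and multiple edges. A $(p,q)$-graph has $p$ vertices and $q$ edges; $[a,b]=\{a,\dots,b\}$. An edge-magic labeling of a $(p,q)$-graph $G$ is a bijection $f:V(G)\cup E(G)\to[1,p+q]$ such that $f(x)+f(xy)+f(y)$ is a constant $\mathrm{val}(f)$ (the valence) for all edges $xy$ (for a loop $e$ at $x$: $2f(x)+f(e)$); $G$ is edge-magic if it has one. For a graph $G=(V,E)$ with $q$ edges, let $T_G=\{(\sum_{u\in V}\deg(u)g(u)+\sum_{e\in E}g(e))/q : g:V\cup E\to[1,p+q]\text{ bijective}\}$, $J_G=[\lceil\min T_G\rceil,\lfloor\max T_G\rfloor]$, and the magic set $\tau_G=\{m\in J_G: m\text{ is the valence of some edge-magic labeling of }G\}$. For a digraph, $\tau$ is that of its underlying graph. $K_{1,n}^l$ is the star $K_{1,n}$ with a loop at its central vertex. For digraphs $D,F$, $D\otimes F$ has vertex set $V(D)\times V(F)$ and arc $((a,i),(b,j))$ iff $(a,b)\in E(D)$ and $(i,j)\in E(F)$ (a loop is an arc $(x,x)$). -}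

module Defs where

open import Data.Nat using (ℕ; zero; suc; _+_; _*_; _≤_)
open import Data.Fin using (Fin; zero; suc; toℕ; combine; remQuot; _≟_)
open import Data.Bool using (Bool; true; false; if_then_else_)
open import Data.Product using (_×_; _,_; proj₁; proj₂; ∃; ∃-syntax; Σ)
open import Data.Sum using (_⊎_; inj₁; inj₂)
open import Data.List using (List; map; allFin; length)
open import Data.Nat.ListAction using (sum)
open import Data.List.Membership.Propositional using (_∈_)
open import Data.List.Relation.Unary.Unique.Propositional using (Unique)
open import Function.Bundles using (_⤖_; Bijection)
open import Relation.Nullary.Decidable using (⌊_⌋)
open import Relation.Binary.PropositionalEquality using (_≡_)

-- A (p,q)-graph (loops and multiple edges allowed): vertices Fin p, edges Fin q,
-- each edge has two endpoints (unordered meaning; a loop has equal endpoints).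
record Graph : Set where
  field
    p    : ℕ
    q    : ℕ
    ends : Fin q → Fin p × Fin p

record Digraph : Set where
  field
    p   : ℕ
    q   : ℕ
    arc : Fin q → Fin p × Fin p

underlying : Digraph → Graph
underlying D = record { p = Digraph.p D ; q = Digraph.q D ; ends = Digraph.arc D }

swap′ : {A : Set} → A × A → A × A
swap′ (a , b) = (b , a)

orient : (G : Graph) → (Fin (Graph.q G) → Bool) → Digraph
orient G o = record
  { p = Graph.p G ; q = Graph.q G
  ; arc = λ e → if o e then swap′ (Graph.ends G e) else Graph.ends G e }

-- K_{1,n} with a loop at the centre (vertex zero); edge zero is the loop,
-- edge (suc i) joins the centre to leaf (suc i).
K1nl : ℕ → Graph
K1nl n = record { p = suc n ; q = suc n ; ends = e }
  where
  e : Fin (suc n) → Fin (suc n) × Fin (suc n)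
  e zero    = (zero , zero)
  e (suc i) = (zero , suc i)

_⊗_ : Digraph → Digraph → Digraph
D ⊗ F = record
  { p = Digraph.p D * Digraph.p F
  ; q = Digraph.q D * Digraph.q F
  ; arc = λ k → ar (remQuot (Digraph.q F) k) }
  where
  ar : Fin (Digraph.q D) × Fin (Digraph.q F) → Fin (Digraph.p D * Digraph.p F) × Fin (Digraph.p D * Digraph.p F)
  ar (e , e′) = combine (proj₁ (Digraph.arc D e)) (proj₁ (Digraph.arc F e′))
              , combine (proj₂ (Digraph.arc D e)) (proj₂ (Digraph.arc F e′))

-- Bijections V ∪ E → [1, p+q], encoded via Fin (p+q) (label = 1 + index).
Labeling : Graph → Set
Labeling G = (Fin (Graph.p G) ⊎ Fin (Graph.q G)) ⤖ Fin (Graph.p G + Graph.q G)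

lab : (G : Graph) → Labeling G → Fin (Graph.p G) ⊎ Fin (Graph.q G) → ℕ
lab G f x = suc (toℕ (Bijection.to f x))

-- f is edge-magic with valence m (for a loop this reads 2 f(x) + f(e) = m).
IsValence : (G : Graph) → Labeling G → ℕ → Set
IsValence G f m = ∀ e →
  lab G f (inj₁ (proj₁ (Graph.ends G e))) + lab G f (inj₂ e)
    + lab G f (inj₁ (proj₂ (Graph.ends G e))) ≡ m

IsMagicValence : Graph → ℕ → Set
IsMagicValence G m = Σ (Labeling G) λ f → IsValence G f m

EdgeMagic : Graph → Set
EdgeMagic G = ∃ λ m → IsMagicValence G m

-- degree (a loop contributes 2)
indic : {k : ℕ} → Fin k → Fin k → ℕ
indic a b = if ⌊ a ≟ b ⌋ then 1 else 0

deg : (G : Graph) → Fin (Graph.p G) → ℕ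
deg G u = sum (map (λ e → indic (proj₁ (Graph.ends G e)) u + indic (proj₂ (Graph.ends G e)) u)
                   (allFin (Graph.q G)))

-- q times the element of T_G given by the bijection g
qT : (G : Graph) → Labeling G → ℕ
qT G g = sum (map (λ u → deg G u * lab G g (inj₁ u)) (allFin (Graph.p G)))
       + sum (map (λ e → lab G g (inj₂ e)) (allFin (Graph.q G)))

-- m ∈ J_G = [⌈min T_G⌉, ⌊max T_G⌋]  ⟺  min T_G ≤ m ≤ max T_G  (m an integer)
InJ : Graph → ℕ → Set
InJ G m = (Σ (Labeling G) λ g → qT G g ≤ Graph.q G * m)
        × (Σ (Labeling G) λ g → Graph.q G * m ≤ qT G g)

InTau : Graph → ℕ → Set
InTau G m = InJ G m × IsMagicValence G m

InTauD : Digraph → ℕ → Set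
InTauD D = InTau (underlying D)

IsMinValence : Graph → ℕ → Set
IsMinValence G α = IsMagicValence G α × (∀ m → IsMagicValence G m → α ≤ m)

IsMaxValence : Graph → ℕ → Set
IsMaxValence G β = IsMagicValence G β × (∀ m → IsMagicValence G m → m ≤ β)

HasSize : (ℕ → Set) → ℕ → Set
HasSize P k = Σ (List ℕ) λ xs → Unique xs × length xs ≡ k
              × (∀ m → (P m → m ∈ xs) × (m ∈ xs → P m))

module Submission where

-- Write a valence of an edge-magic labeling as 3 + r, r being its excess: the
-- constant edge sum of the 0-based labels.  If D has a labeling with excess r and the
-- vertices and the edges of F carry bijective labels in Fin s with constant edge sum
-- r′, then labelling D ⊗ F by A·(label in D) + B·(label in F), through a bijective
-- encoding of Fin (p+q) × Fin s with weights (A, B), is edge-magic with excess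
-- A·r + B·r′.  On the looped star every permutation π of Fin (n+1) gives such labels
-- (π, reverse ∘ π) with r′ = π(0) + n.  The colexicographic (1, p+q) and the
-- lexicographic (n+1, 1) encodings turn each excess r of G into the n + 3 excesses
-- r + N·n, r + 2N·n and (n+1)·r + s + n (s ≤ n) of the product, N = p + q.  The theorem then
-- counts these pairwise distinct valences of the product.

open import Defs
open import Data.Nat using (ℕ; zero; suc; _+_; _*_; _∸_; _≤_; _<_; z≤n; s≤s; NonZero)
open import Data.Nat.Properties
open import Data.Nat.DivMod using (_%_; [m+kn]%n≡m%n; m<n⇒m%n≡m)
open import Data.Nat.ListAction using (sum)
open import Data.Nat.Tactic.RingSolver using (solve-∀)
open import Data.Integer using (+_; _-_) renaming (_<_ to _<ℤ_; _*_ to _*ℤ_)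
import Data.Integer as ℤ
import Data.Integer.Properties as ℤ
import Data.Integer.Tactic.RingSolver as ℤ-Solver
open import Data.Fin using (Fin; zero; suc; toℕ; fromℕ; combine; remQuot; opposite)
import Data.Fin.Properties as Fin
open import Data.Fin.Properties
  using (toℕ<n; toℕ-fromℕ; toℕ-cast; toℕ-combine; toℕ-injective; opposite-prop;
         remQuot-combine; combine-remQuot; injective⇒≤; *↔×; +↔⊎)
open import Data.Fin.Permutation using (transpose; reverse; cast-id; ↔⇒≡)
open import Data.Bool using (Bool; true; false)
open import Data.Product using (_×_; _,_; proj₁; proj₂)
open import Data.Product.Algebra using (×-distribʳ-⊎; ×-comm)
open import Data.Product.Function.NonDependent.Propositional using (_×-↔_)
open import Data.Sum using (_⊎_; inj₁; inj₂)
open import Data.Sum.Function.Propositional using (_⊎-↔_)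
open import Data.List using (List; _∷_; length; lookup; map; allFin; tabulate)
open import Data.List.Properties using (map-tabulate)
open import Data.List.Membership.Propositional using (_∈_)
open import Data.List.Membership.Propositional.Properties using (∈-lookup)
open import Data.List.Relation.Unary.Any using (index)
open import Data.List.Relation.Unary.Any.Properties using (lookup-index)
import Data.List.Relation.Unary.All as All
open import Data.List.Relation.Unary.AllPairs using (_∷_)
open import Data.List.Relation.Unary.Unique.Propositional using (Unique)
open import Data.Empty using (⊥-elim)
open import Relation.Nullary using (yes; no)
open import Function using (_∘_)
open import Function.Bundles using (Inverse; Bijection; _↔_)
open import Function.Properties.Inverse using (↔⇒⤖; ↔-sym; ↔-trans; ↔-refl)
open import Function.Properties.Bijection using (⤖⇒↔)
open import Relation.Binary.PropositionalEquality
open import Algebra.Properties.Semiring.Sum +-*-semiring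
  using (sum-syntax; ∑-comm; ∑-distrib-+; *-distribʳ-sum) renaming (sum to ∑)

open Inverse using (to)

sum-allFin : ∀ p (h : Fin p → ℕ) → sum (map h (allFin p)) ≡ ∑[ u < p ] h u
sum-allFin p h = trans (cong sum (map-tabulate (λ u → u) h)) (sum-tabulate p h)
  where
  sum-tabulate : ∀ p (h : Fin p → ℕ) → sum (tabulate h) ≡ ∑[ u < p ] h u
  sum-tabulate zero    h = refl
  sum-tabulate (suc p) h = cong (_+_ (h zero)) (sum-tabulate p (h ∘ suc))

∑-cong : ∀ p {g h : Fin p → ℕ} → (∀ u → g u ≡ h u) → ∑[ u < p ] g u ≡ ∑[ u < p ] h u
∑-cong zero    eq = refl
∑-cong (suc p) eq = cong₂ _+_ (eq zero) (∑-cong p (eq ∘ suc))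

∑-const : ∀ q m → ∑[ e < q ] m ≡ q * m
∑-const zero    m = refl
∑-const (suc q) m = cong (_+_ m) (∑-const q m)

indic-suc : ∀ {p} (a u : Fin p) → indic (suc a) (suc u) ≡ indic a u
indic-suc a u with a Fin.≟ u | suc a Fin.≟ suc u
... | yes _   | yes _   = refl
... | no _    | no _    = refl
... | yes a≡u | no a≢u  = ⊥-elim (a≢u (cong suc a≡u))
... | no a≢u  | yes a≡u = ⊥-elim (a≢u (Fin.suc-injective a≡u))

∑-indic : ∀ p (a : Fin p) (c : Fin p → ℕ) → ∑[ u < p ] (indic a u * c u) ≡ c a
∑-indic (suc p) zero c = begin
    c zero + 0 + ∑[ u < p ] (0 * c (suc u))  ≡⟨ cong₂ _+_ (+-identityʳ (c zero)) (∑-const p 0) ⟩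
    c zero + p * 0                           ≡⟨ cong (_+_ (c zero)) (*-zeroʳ p) ⟩
    c zero + 0                               ≡⟨ +-identityʳ (c zero) ⟩
    c zero                                   ∎
  where open ≡-Reasoning
∑-indic (suc p) (suc a) c =
  trans (∑-cong p (λ u → cong (_* c (suc u)) (indic-suc a u))) (∑-indic p a (c ∘ suc))

-- Handshake identity: weighting vertices by degree counts each edge at both ends.
handshake : (G : Graph) (v : Fin (Graph.p G) → ℕ) →
  sum (map (λ u → deg G u * v u) (allFin (Graph.p G)))
    ≡ ∑[ e < Graph.q G ] (v (proj₁ (Graph.ends G e)) + v (proj₂ (Graph.ends G e)))
handshake G v = begin
    sum (map (λ u → deg G u * v u) (allFin p))
  ≡⟨ sum-allFin p _ ⟩
    ∑[ u < p ] (deg G u * v u)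
  ≡⟨ ∑-cong p (λ u → cong (_* v u) (sum-allFin q (λ e → I e u))) ⟩
    ∑[ u < p ] (∑[ e < q ] I e u * v u)
  ≡⟨ ∑-cong p (λ u → *-distribʳ-sum (v u) (λ e → I e u)) ⟩
    ∑[ u < p ] ∑[ e < q ] (I e u * v u)
  ≡⟨ ∑-comm (λ u e → I e u * v u) ⟩
    ∑[ e < q ] ∑[ u < p ] (I e u * v u)
  ≡⟨ ∑-cong q (λ e → ends-picked e) ⟩
    ∑[ e < q ] (v (x e) + v (y e))
  ∎
  where
  open ≡-Reasoning
  p = Graph.p G
  q = Graph.q G
  x y : Fin q → Fin p
  x e = proj₁ (Graph.ends G e)
  y e = proj₂ (Graph.ends G e)
  I : Fin q → Fin p → ℕ
  I e u = indic (x e) u + indic (y e) u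
  ends-picked : ∀ e → ∑[ u < p ] (I e u * v u) ≡ v (x e) + v (y e)
  ends-picked e = begin
      ∑[ u < p ] (I e u * v u)
    ≡⟨ ∑-cong p (λ u → *-distribʳ-+ (v u) (indic (x e) u) (indic (y e) u)) ⟩
      ∑[ u < p ] (indic (x e) u * v u + indic (y e) u * v u)
    ≡⟨ ∑-distrib-+ (λ u → indic (x e) u * v u) (λ u → indic (y e) u * v u) ⟩
      ∑[ u < p ] (indic (x e) u * v u) + ∑[ u < p ] (indic (y e) u * v u)
    ≡⟨ cong₂ _+_ (∑-indic p (x e) v) (∑-indic p (y e) v) ⟩
      v (x e) + v (y e)
    ∎

qT-valence : (G : Graph) (f : Labeling G) (m : ℕ) → IsValence G f m → qT G f ≡ Graph.q G * m
qT-valence G f m valence = begin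
    qT G f
  ≡⟨ cong₂ _+_ (handshake G (L ∘ inj₁)) (sum-allFin q (L ∘ inj₂)) ⟩
    ∑[ e < q ] (L (inj₁ (x e)) + L (inj₁ (y e))) + ∑[ e < q ] L (inj₂ e)
  ≡⟨ sym (∑-distrib-+ (λ e → L (inj₁ (x e)) + L (inj₁ (y e))) (L ∘ inj₂)) ⟩
    ∑[ e < q ] (L (inj₁ (x e)) + L (inj₁ (y e)) + L (inj₂ e))
  ≡⟨ ∑-cong q (λ e → trans (swap-last (L (inj₁ (x e))) _ _) (valence e)) ⟩
    ∑[ e < q ] m
  ≡⟨ ∑-const q m ⟩
    q * m
  ∎
  where
  open ≡-Reasoning
  q = Graph.q G
  L = lab G f
  x y : Fin q → Fin (Graph.p G)
  x e = proj₁ (Graph.ends G e)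
  y e = proj₂ (Graph.ends G e)
  swap-last : ∀ a b c → a + b + c ≡ a + c + b
  swap-last = solve-∀

valence-in-τ : (G : Graph) (m : ℕ) → IsMagicValence G m → InTau G m
valence-in-τ G m (f , valence) =
  ((f , ≤-reflexive (qT-valence G f m valence)) , (f , ≤-reflexive (sym (qT-valence G f m valence))))
  , (f , valence)

opposite-+ : ∀ {N} (i : Fin N) → toℕ (opposite i) + suc (toℕ i) ≡ N
opposite-+ i = trans (cong (_+ suc (toℕ i)) (opposite-prop i)) (m∸n+n≡m (toℕ<n i))

complement : (G : Graph) → Labeling G → Labeling G
complement G f = ↔⇒⤖ (↔-trans (⤖⇒↔ f) reverse)

complement-valence : (G : Graph) (f : Labeling G) (m : ℕ) → IsValence G f m →
  IsValence G (complement G f) (3 * suc (Graph.p G + Graph.q G) ∸ m)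
complement-valence G f m valence e = begin
    S′
  ≡⟨ sym (m+n∸n≡m S′ m) ⟩
    S′ + m ∸ m
  ≡⟨ cong (λ t → S′ + t ∸ m) (sym (valence e)) ⟩
    S′ + (lab G f X + lab G f E + lab G f Y) ∸ m
  ≡⟨ cong (_∸ m) (regroup (lab G f X) (lab G f E) (lab G f Y) (lab G fᶜ X) (lab G fᶜ E) (lab G fᶜ Y)) ⟩
    (lab G fᶜ X + lab G f X) + (lab G fᶜ E + lab G f E) + (lab G fᶜ Y + lab G f Y) ∸ m
  ≡⟨ cong (_∸ m) (cong₂ _+_ (cong₂ _+_ (pair X) (pair E)) (pair Y)) ⟩
    suc N + suc N + suc N ∸ m
  ≡⟨ cong (_∸ m) (triple N) ⟩
    3 * suc N ∸ m
  ∎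
  where
  open ≡-Reasoning
  N = Graph.p G + Graph.q G
  fᶜ = complement G f
  X = inj₁ (proj₁ (Graph.ends G e))
  Y = inj₁ (proj₂ (Graph.ends G e))
  E = inj₂ e
  S′ = lab G fᶜ X + lab G fᶜ E + lab G fᶜ Y
  pair : ∀ z → lab G fᶜ z + lab G f z ≡ suc N
  pair z = cong suc (opposite-+ (Bijection.to f z))
  regroup : ∀ a b c a′ b′ c′ → a′ + b′ + c′ + (a + b + c) ≡ (a′ + a) + (b′ + b) + (c′ + c)
  regroup = solve-∀
  triple : ∀ N → suc N + suc N + suc N ≡ 3 * suc N
  triple = solve-∀

-- The complement of a labeling with valence β has valence 3(N+1) − β ≥ α, so the
-- extreme valences satisfy α + β ≤ 3(N+1).
extreme-valences-sum : (G : Graph) (α β : ℕ) → 0 < α → IsMinValence G α → IsMaxValence G β →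
  α + β ≤ 3 * suc (Graph.p G + Graph.q G)
extreme-valences-sum G α β 0<α (_ , α-min) ((f , valence) , _) = m≤o∸n⇒m+n≤o α β≤X α≤X∸β
  where
  X = 3 * suc (Graph.p G + Graph.q G)
  α≤X∸β : α ≤ X ∸ β
  α≤X∸β = α-min _ (complement G f , complement-valence G f β valence)
  β≤X : β ≤ X
  β≤X = <⇒≤ (m∸n≢0⇒n<m (m>n⇒m∸n≢0 (≤-trans 0<α α≤X∸β)))

-- Vertex weights v and edge weights w of G with every edge sum equal to r;
-- IsValence G f m is exactly this property of the labels of f.
ConstantEdgeSum : (G : Graph) → (Fin (Graph.p G) → ℕ) → (Fin (Graph.q G) → ℕ) → ℕ → Set
ConstantEdgeSum G v w r = ∀ e → v (proj₁ (Graph.ends G e)) + w e + v (proj₂ (Graph.ends G e)) ≡ r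

ConstantEdgeSum-cong : (G : Graph) {v v′ : Fin (Graph.p G) → ℕ} {w w′ : Fin (Graph.q G) → ℕ} {r : ℕ} →
  (∀ x → v x ≡ v′ x) → (∀ e → w e ≡ w′ e) → ConstantEdgeSum G v w r → ConstantEdgeSum G v′ w′ r
ConstantEdgeSum-cong G v≗v′ w≗w′ sums e =
  trans (sym (cong₂ _+_ (cong₂ _+_ (v≗v′ _) (w≗w′ e)) (v≗v′ _))) (sums e)

orient-sum : (G : Graph) (o : Fin (Graph.q G) → Bool) {v : Fin (Graph.p G) → ℕ}
  {w : Fin (Graph.q G) → ℕ} {r : ℕ} →
  ConstantEdgeSum G v w r → ConstantEdgeSum (underlying (orient G o)) v w r
orient-sum G o {v} {w} sums e with o e
... | false = sums e
... | true  = trans (reverse-sum (v (proj₂ (Graph.ends G e))) (w e) _) (sums e)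
  where
  reverse-sum : ∀ a b c → a + b + c ≡ c + b + a
  reverse-sum = solve-∀

-- Labels are 1-based: shifting all weights by one shifts the edge sums by three.
three-sucs : ∀ a b c → suc a + suc b + suc c ≡ 3 + (a + b + c)
three-sucs = solve-∀

shift-sum : (G : Graph) {v : Fin (Graph.p G) → ℕ} {w : Fin (Graph.q G) → ℕ} {r : ℕ} →
  ConstantEdgeSum G (suc ∘ v) (suc ∘ w) (3 + r) → ConstantEdgeSum G v w r
shift-sum G sums e = +-cancelˡ-≡ 3 _ _ (trans (sym (three-sucs _ _ _)) (sums e))

unshift-sum : (G : Graph) {v : Fin (Graph.p G) → ℕ} {w : Fin (Graph.q G) → ℕ} {r : ℕ} →
  ConstantEdgeSum G v w r → ConstantEdgeSum G (suc ∘ v) (suc ∘ w) (3 + r)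
unshift-sum G sums e = trans (three-sucs _ _ _) (cong (_+_ 3) (sums e))

combineWeights : ∀ {m k} (A B : ℕ) → (Fin m → ℕ) → (Fin k → ℕ) → Fin (m * k) → ℕ
combineWeights {m} {k} A B v v′ z = A * v (proj₁ (remQuot {m} k z)) + B * v′ (proj₂ (remQuot {m} k z))

combineWeights-combine : ∀ {m k} (A B : ℕ) (v : Fin m → ℕ) (v′ : Fin k → ℕ) (x : Fin m) (i : Fin k) →
  combineWeights A B v v′ (combine x i) ≡ A * v x + B * v′ i
combineWeights-combine A B v v′ x i = cong (λ z → A * v (proj₁ z) + B * v′ (proj₂ z)) (remQuot-combine x i)

product-sum : (D F : Digraph) (A B : ℕ)
  {v : Fin (Digraph.p D) → ℕ} {w : Fin (Digraph.q D) → ℕ} {r : ℕ}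
  {v′ : Fin (Digraph.p F) → ℕ} {w′ : Fin (Digraph.q F) → ℕ} {r′ : ℕ} →
  ConstantEdgeSum (underlying D) v w r → ConstantEdgeSum (underlying F) v′ w′ r′ →
  ConstantEdgeSum (underlying (D ⊗ F)) (combineWeights A B v v′) (combineWeights A B w w′) (A * r + B * r′)
product-sum D F A B {v} {w} {r} {v′} {w′} {r′} sumsD sumsF k = begin
    combineWeights A B v v′ (combine x₁ u₁) + combineWeights A B w w′ k + combineWeights A B v v′ (combine x₂ u₂)
  ≡⟨ cong₂ (λ a b → a + combineWeights A B w w′ k + b)
           (combineWeights-combine A B v v′ x₁ u₁) (combineWeights-combine A B v v′ x₂ u₂) ⟩
    (A * v x₁ + B * v′ u₁) + (A * w e + B * w′ e′) + (A * v x₂ + B * v′ u₂)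
  ≡⟨ regroup A B (v x₁) (w e) (v x₂) (v′ u₁) (w′ e′) (v′ u₂) ⟩
    A * (v x₁ + w e + v x₂) + B * (v′ u₁ + w′ e′ + v′ u₂)
  ≡⟨ cong₂ (λ a b → A * a + B * b) (sumsD e) (sumsF e′) ⟩
    A * r + B * r′
  ∎
  where
  open ≡-Reasoning
  e = proj₁ (remQuot {Digraph.q D} (Digraph.q F) k)
  e′ = proj₂ (remQuot {Digraph.q D} (Digraph.q F) k)
  x₁ = proj₁ (Digraph.arc D e)
  x₂ = proj₂ (Digraph.arc D e)
  u₁ = proj₁ (Digraph.arc F e′)
  u₂ = proj₂ (Digraph.arc F e′)
  regroup : ∀ A B a b c a′ b′ c′ →
    (A * a + B * a′) + (A * b + B * b′) + (A * c + B * c′) ≡ A * (a + b + c) + B * (a′ + b′ + c′)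
  regroup = solve-∀

-- From a labeling f of D, bijections α, γ labelling the vertices and the edges of F
-- by Fin s, and an encoding Φ of Fin (p+q) × Fin s, label (x, i) by Φ (f x, α i) and
-- (e, e′) by Φ (f e, γ e′).
module ProductLabeling (D F : Digraph) {s M : ℕ}
  (f : Labeling (underlying D))
  (α : Fin (Digraph.p F) ↔ Fin s) (γ : Fin (Digraph.q F) ↔ Fin s)
  (Φ : (Fin (Digraph.p D + Digraph.q D) × Fin s) ↔ Fin M) where

  H : Graph
  H = underlying (D ⊗ F)

  encode : (Fin (Graph.p H) ⊎ Fin (Graph.q H)) ↔ Fin M
  encode =
    ↔-trans (*↔× ⊎-↔ *↔×)
    (↔-trans ((↔-refl ×-↔ α) ⊎-↔ (↔-refl ×-↔ γ))
    (↔-trans (↔-sym (×-distribʳ-⊎ _ _ _ _))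
    (↔-trans (⤖⇒↔ f ×-↔ ↔-refl) Φ)))

  -- Bijective finite sets have equal size, so encode is a labeling up to a cast.
  size : Graph.p H + Graph.q H ≡ M
  size = ↔⇒≡ (↔-trans +↔⊎ encode)

  labeling : Labeling H
  labeling = ↔⇒⤖ (↔-trans encode (cast-id (sym size)))

  Λ : Fin (Digraph.p D) ⊎ Fin (Digraph.q D) → ℕ
  Λ z = toℕ (Bijection.to f z)

  module _ (A B : ℕ) (Φ-weights : ∀ a t → toℕ (to Φ (a , t)) ≡ A * toℕ a + B * toℕ t) where

    lab-vertex : ∀ z → lab H labeling (inj₁ z) ≡ suc (combineWeights A B (Λ ∘ inj₁) (toℕ ∘ to α) z)
    lab-vertex z = cong suc (trans (toℕ-cast (sym size) _) (Φ-weights _ _))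

    lab-edge : ∀ k → lab H labeling (inj₂ k) ≡ suc (combineWeights A B (Λ ∘ inj₂) (toℕ ∘ to γ) k)
    lab-edge k = cong suc (trans (toℕ-cast (sym size) _) (Φ-weights _ _))

    product-valence : ∀ {r r′} → IsValence (underlying D) f (3 + r) →
      ConstantEdgeSum (underlying F) (toℕ ∘ to α) (toℕ ∘ to γ) r′ →
      IsValence H labeling (3 + (A * r + B * r′))
    product-valence {r} {r′} valence sumsF =
      ConstantEdgeSum-cong H (sym ∘ lab-vertex) (sym ∘ lab-edge) (unshift-sum H {vH} {wH} sumsH)
      where
      vH : Fin (Graph.p H) → ℕ
      vH = combineWeights A B (Λ ∘ inj₁) (toℕ ∘ to α)
      wH : Fin (Graph.q H) → ℕ
      wH = combineWeights A B (Λ ∘ inj₂) (toℕ ∘ to γ)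
      sumsD : ConstantEdgeSum (underlying D) (Λ ∘ inj₁) (Λ ∘ inj₂) r
      sumsD = shift-sum (underlying D) {Λ ∘ inj₁} {Λ ∘ inj₂} valence
      sumsH : ConstantEdgeSum H vH wH (A * r + B * r′)
      sumsH = product-sum D F A B {Λ ∘ inj₁} {Λ ∘ inj₂} {v′ = toℕ ∘ to α} {toℕ ∘ to γ} sumsD sumsF

lexicographic : ∀ {N s} → (Fin N × Fin s) ↔ Fin (N * s)
lexicographic = ↔-sym *↔×

lexicographic-weights : ∀ {N s} (a : Fin N) (t : Fin s) →
  toℕ (to lexicographic (a , t)) ≡ s * toℕ a + 1 * toℕ t
lexicographic-weights {s = s} a t = trans (toℕ-combine a t) (cong (_+_ (s * toℕ a)) (sym (*-identityˡ (toℕ t))))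

colexicographic : ∀ {N s} → (Fin N × Fin s) ↔ Fin (s * N)
colexicographic = ↔-trans (×-comm _ _) (↔-sym *↔×)

colexicographic-weights : ∀ {N s} (a : Fin N) (t : Fin s) →
  toℕ (to colexicographic (a , t)) ≡ 1 * toℕ a + N * toℕ t
colexicographic-weights {N} a t =
  trans (toℕ-combine t a) (trans (+-comm (N * toℕ t) (toℕ a)) (cong (_+ N * toℕ t) (sym (*-identityˡ (toℕ a)))))

centre-edge-sum : (n : ℕ) (π : Fin (suc n) ↔ Fin (suc n)) (j : Fin (suc n)) →
  toℕ (to π zero) + toℕ (opposite (to π j)) + toℕ (to π j) ≡ toℕ (to π zero) + n
centre-edge-sum n π j = trans (+-assoc (toℕ (to π zero)) _ _)
  (cong (_+_ (toℕ (to π zero))) (suc-injective (trans (sym (+-suc _ _)) (opposite-+ (to π j)))))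

-- Every edge of K_{1,n}^l, the loop included, is of that form.
star-sum : (n : ℕ) (π : Fin (suc n) ↔ Fin (suc n)) →
  ConstantEdgeSum (K1nl n) (toℕ ∘ to π) (toℕ ∘ to (↔-trans π reverse)) (toℕ (to π zero) + n)
star-sum n π zero    = centre-edge-sum n π zero
star-sum n π (suc i) = centre-edge-sum n π (suc i)

-- Excesses of the product built from an excess r of G (N = p + q): two from the
-- colexicographic encoding (π = transposition of 0 and s for s = 0 and s = n) and n + 1
-- from the lexicographic one (π = transposition of 0 and s).
liftedExcess : (N n r : ℕ) → Fin (3 + n) → ℕ
liftedExcess N n r zero          = r + N * n
liftedExcess N n r (suc zero)    = r + N * (n + n)
liftedExcess N n r (suc (suc s)) = suc n * r + (toℕ s + n)

module StarProduct (G : Graph) (n : ℕ) (oG : Fin (Graph.q G) → Bool) (oK : Fin (suc n) → Bool) where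

  N : ℕ
  N = Graph.p G + Graph.q G

  H : Graph
  H = underlying (orient G oG ⊗ orient (K1nl n) oK)

  star-valence : ∀ {M} (Φ : (Fin N × Fin (suc n)) ↔ Fin M) (A B : ℕ) →
    (∀ a t → toℕ (to Φ (a , t)) ≡ A * toℕ a + B * toℕ t) →
    ∀ {r} → IsMagicValence G (3 + r) → (s : Fin (suc n)) →
    IsMagicValence H (3 + (A * r + B * (toℕ s + n)))
  star-valence Φ A B Φ-weights (f , valence) s =
    labeling , product-valence A B Φ-weights (orient-sum G oG {lab G f ∘ inj₁} {lab G f ∘ inj₂} valence)
                 (orient-sum (K1nl n) oK {toℕ ∘ to π} {toℕ ∘ to (↔-trans π reverse)} (star-sum n π))
    where
    π : Fin (suc n) ↔ Fin (suc n)
    π = transpose zero s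
    open ProductLabeling (orient G oG) (orient (K1nl n) oK) f π (↔-trans π reverse) Φ

  lifted-valence : ∀ {r} → IsMagicValence G (3 + r) → ∀ j → IsMagicValence H (3 + liftedExcess N n r j)
  lifted-valence {r} valence zero =
    subst (IsMagicValence H) (cong (λ t → 3 + (t + N * n)) (*-identityˡ r))
      (star-valence colexicographic 1 N colexicographic-weights valence zero)
  lifted-valence {r} valence (suc zero) =
    subst (IsMagicValence H) (cong₂ (λ t u → 3 + (t + N * (u + n))) (*-identityˡ r) (toℕ-fromℕ n))
      (star-valence colexicographic 1 N colexicographic-weights valence (fromℕ n))
  lifted-valence {r} valence (suc (suc s)) =
    subst (IsMagicValence H) (cong (λ t → 3 + (suc n * r + t)) (*-identityˡ (toℕ s + n)))
      (star-valence lexicographic (suc n) 1 lexicographic-weights valence s)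

quotient-unique : ∀ d .{{_ : NonZero d}} {t t′ r r′ : ℕ} → t < d → t′ < d →
  t + r * d ≡ t′ + r′ * d → t ≡ t′ × r ≡ r′
quotient-unique d {t} {t′} {r} {r′} t<d t′<d eq =
  t≡t′ , *-cancelʳ-≡ r r′ d (+-cancelˡ-≡ t _ _ (trans eq (cong (_+ r′ * d) (sym t≡t′))))
  where
  open ≡-Reasoning
  t≡t′ : t ≡ t′
  t≡t′ = begin
    t                ≡⟨ sym (m<n⇒m%n≡m t<d) ⟩
    t % d            ≡⟨ sym ([m+kn]%n≡m%n t r d) ⟩
    (t + r * d) % d  ≡⟨ cong (_% d) eq ⟩
    (t′ + r′ * d) % d ≡⟨ [m+kn]%n≡m%n t′ r′ d ⟩
    t′ % d           ≡⟨ m<n⇒m%n≡m t′<d ⟩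
    t′               ∎

-- Excesses r ∈ [c, b], where 3 + c = α and 3 + b = β are the extreme valences of G;
-- gap is the hypothesis β + (N+2)·n < α + α·n of the theorem, sum-bound is α + β ≤ 3(N+1).
module Separation (N n c b : ℕ)
  (gap : 3 + b + (N + 2) * n < 3 + c + (3 + c) * n)
  (sum-bound : 3 + c + (3 + b) ≤ 3 * suc N) where

  open ≤-Reasoning

  gap′ : b + (N + 2) * n < c + (3 + c) * n
  gap′ = +-cancelˡ-< 3 _ _ gap

  low<mid : ∀ {r r′} t → r ≤ b → c ≤ r′ → r + N * n < suc n * r′ + (t + n)
  low<mid {r} {r′} t r≤b c≤r′ = +-cancelʳ-< (2 * n) _ _ (begin-strict
      r + N * n + 2 * n              ≡⟨ collect r N n ⟩
      r + (N + 2) * n                ≤⟨ +-monoˡ-≤ ((N + 2) * n) r≤b ⟩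
      b + (N + 2) * n                <⟨ gap′ ⟩
      c + (3 + c) * n                ≤⟨ +-mono-≤ c≤r′ (*-monoˡ-≤ n (+-monoʳ-≤ 3 c≤r′)) ⟩
      r′ + (3 + r′) * n              ≡⟨ spread r′ n ⟩
      suc n * r′ + (0 + n) + 2 * n   ≤⟨ +-monoˡ-≤ (2 * n) (+-monoʳ-≤ (suc n * r′) (+-monoˡ-≤ n z≤n)) ⟩
      suc n * r′ + (t + n) + 2 * n   ∎)
    where
    collect : ∀ r N n → r + N * n + 2 * n ≡ r + (N + 2) * n
    collect = solve-∀
    spread : ∀ r n → r + (3 + r) * n ≡ suc n * r + (0 + n) + 2 * n
    spread = solve-∀

  mid<high : ∀ {r r′ t} → r ≤ b → c ≤ r′ → t ≤ n → suc n * r + (t + n) < r′ + N * (n + n)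
  mid<high {r} {r′} {t} r≤b c≤r′ t≤n = begin-strict
      suc n * r + (t + n)  ≤⟨ +-mono-≤ (*-monoʳ-≤ (suc n) r≤b) (+-monoˡ-≤ n t≤n) ⟩
      suc n * b + (n + n)  <⟨ extremes ⟩
      c + N * (n + n)      ≤⟨ +-monoˡ-≤ (N * (n + n)) c≤r′ ⟩
      r′ + N * (n + n)     ∎
    where
    K = N * n + 6 * n + n * c
    extremes : suc n * b + (n + n) < c + N * (n + n)
    extremes = +-cancelʳ-< K _ _ (begin-strict
        suc n * b + (n + n) + K                    ≡⟨ split-left b c N n ⟩
        b + (N + 2) * n + n * (3 + c + (3 + b))    <⟨ +-mono-<-≤ gap′ (*-monoʳ-≤ n sum-bound) ⟩
        c + (3 + c) * n + n * (3 * suc N)          ≡⟨ split-right c N n ⟩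
        c + N * (n + n) + K                        ∎)
      where
      split-left : ∀ b c N n →
        suc n * b + (n + n) + (N * n + 6 * n + n * c) ≡ b + (N + 2) * n + n * (3 + c + (3 + b))
      split-left = solve-∀
      split-right : ∀ c N n →
        c + (3 + c) * n + n * (3 * suc N) ≡ c + N * (n + n) + (N * n + 6 * n + n * c)
      split-right = solve-∀

  low<high : ∀ {r r′} → c ≤ r → r ≤ b → c ≤ r′ → r + N * n < r′ + N * (n + n)
  low<high c≤r r≤b c≤r′ = <-trans (low<mid 0 r≤b c≤r) (mid<high r≤b c≤r′ z≤n)

  -- The middle values determine r and t, t being a remainder modulo n + 1.
  mid-injective : ∀ {r r′} (s s′ : Fin (suc n)) →
    suc n * r + (toℕ s + n) ≡ suc n * r′ + (toℕ s′ + n) → r ≡ r′ × s ≡ s′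
  mid-injective {r} {r′} s s′ eq =
    let s≡s′ , r≡r′ = quotient-unique (suc n) (toℕ<n s) (toℕ<n s′) (+-cancelʳ-≡ n _ _ eq′)
    in r≡r′ , toℕ-injective s≡s′
    where
    as-division : ∀ n r t → suc n * r + (t + n) ≡ t + r * suc n + n
    as-division = solve-∀
    eq′ : toℕ s + r * suc n + n ≡ toℕ s′ + r′ * suc n + n
    eq′ = trans (sym (as-division n r (toℕ s))) (trans eq (as-division n r′ (toℕ s′)))

  lifted-injective : ∀ {r r′} → c ≤ r → r ≤ b → c ≤ r′ → r′ ≤ b → ∀ j j′ →
    liftedExcess N n r j ≡ liftedExcess N n r′ j′ → r ≡ r′ × j ≡ j′
  lifted-injective {r} {r′} c≤r r≤b c≤r′ r′≤b = separate
    where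
    separate : ∀ j j′ → liftedExcess N n r j ≡ liftedExcess N n r′ j′ → r ≡ r′ × j ≡ j′
    separate zero          zero           eq = +-cancelʳ-≡ (N * n) r r′ eq , refl
    separate zero          (suc zero)     eq = ⊥-elim (<⇒≢ (low<high c≤r r≤b c≤r′) eq)
    separate zero          (suc (suc s′)) eq = ⊥-elim (<⇒≢ (low<mid (toℕ s′) r≤b c≤r′) eq)
    separate (suc zero)    zero           eq = ⊥-elim (<⇒≢ (low<high c≤r′ r′≤b c≤r) (sym eq))
    separate (suc zero)    (suc zero)     eq = +-cancelʳ-≡ (N * (n + n)) r r′ eq , refl
    separate (suc zero)    (suc (suc s′)) eq = ⊥-elim (<⇒≢ (mid<high r′≤b c≤r (≤-pred (toℕ<n s′))) (sym eq))
    separate (suc (suc s)) zero           eq = ⊥-elim (<⇒≢ (low<mid (toℕ s) r′≤b c≤r) (sym eq))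
    separate (suc (suc s)) (suc zero)     eq = ⊥-elim (<⇒≢ (mid<high r≤b c≤r′ (≤-pred (toℕ<n s))) eq)
    separate (suc (suc s)) (suc (suc s′)) eq =
      let r≡r′ , s≡s′ = mid-injective s s′ eq in r≡r′ , cong (λ s → suc (suc s)) s≡s′

lookup-injective : {A : Set} (xs : List A) → Unique xs → ∀ {i j} → lookup xs i ≡ lookup xs j → i ≡ j
lookup-injective (x ∷ xs) _          {zero}  {zero}  eq = refl
lookup-injective (x ∷ xs) (x∉xs ∷ _) {zero}  {suc j} eq = ⊥-elim (All.lookup x∉xs (∈-lookup j) eq)
lookup-injective (x ∷ xs) (x∉xs ∷ _) {suc i} {zero}  eq = ⊥-elim (All.lookup x∉xs (∈-lookup i) (sym eq))
lookup-injective (x ∷ xs) (_ ∷ unique) {suc i} {suc j} eq = cong suc (lookup-injective xs unique eq)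

count-family : {A : Set} {m d : ℕ} (ys : List A) (g : Fin m → Fin d → A) →
  (∀ {i j i′ j′} → g i j ≡ g i′ j′ → i ≡ i′ × j ≡ j′) → (∀ i j → g i j ∈ ys) → m * d ≤ length ys
count-family {m = m} {d} ys g g-injective g∈ys = injective⇒≤ position-injective
  where
  position : Fin (m * d) → Fin (length ys)
  position z = index (g∈ys (proj₁ (remQuot {m} d z)) (proj₂ (remQuot {m} d z)))
  position-injective : ∀ {z z′} → position z ≡ position z′ → z ≡ z′
  position-injective {z} {z′} eq =
    let i≡i′ , j≡j′ = g-injective (trans (lookup-index (g∈ys _ _))
                                    (trans (cong (lookup ys) eq) (sym (lookup-index (g∈ys _ _)))))
    in trans (sym (combine-remQuot {m} d z)) (trans (cong₂ combine i≡i′ j≡j′) (combine-remQuot {m} d z′))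

gap-in-ℕ : ∀ α β c n → (+ β - + α) <ℤ ((+ α - + c) *ℤ + n) → β + c * n < α + α * n
gap-in-ℕ α β c n gap = ℤ.drop‿+<+ (subst₂ ℤ._<_ left right (ℤ.+-monoˡ-< (+ α ℤ.+ + c *ℤ + n) gap))
  where
  cancel-left : ∀ (b a x : ℤ.ℤ) → (b - a) ℤ.+ (a ℤ.+ x) ≡ b ℤ.+ x
  cancel-left = ℤ-Solver.solve-∀
  cancel-right : ∀ (a c n : ℤ.ℤ) → (a - c) *ℤ n ℤ.+ (a ℤ.+ c *ℤ n) ≡ a ℤ.+ a *ℤ n
  cancel-right = ℤ-Solver.solve-∀
  left : (+ β - + α) ℤ.+ (+ α ℤ.+ + c *ℤ + n) ≡ + (β + c * n)
  left = trans (cancel-left (+ β) (+ α) (+ c *ℤ + n))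
           (trans (cong (ℤ._+_ (+ β)) (sym (ℤ.pos-* c n))) (sym (ℤ.pos-+ β (c * n))))
  right : (+ α - + c) *ℤ + n ℤ.+ (+ α ℤ.+ + c *ℤ + n) ≡ + (α + α * n)
  right = trans (cancel-right (+ α) (+ c) (+ n))
            (trans (cong (ℤ._+_ (+ α)) (sym (ℤ.pos-* α n))) (sym (ℤ.pos-+ α (α * n))))

gap-lower-bound : ∀ {α β c n} → β + c * n < α + α * n → α ≤ β → c < α
gap-lower-bound {n = n} gap α≤β = ≰⇒> (λ α≤c → <⇒≱ gap (+-mono-≤ α≤β (*-monoˡ-≤ n α≤c)))

lifted-count : (G : Graph) (n : ℕ) (oG : Fin (Graph.q G) → Bool) (oK : Fin (suc n) → Bool) (α β : ℕ) →
  β + (Graph.p G + Graph.q G + 2) * n < α + α * n → α + β ≤ 3 * suc (Graph.p G + Graph.q G) →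
  3 ≤ α → α ≤ β → (xs ys : List ℕ) → Unique xs →
  (∀ {m} → m ∈ xs → IsMagicValence G m × α ≤ m × m ≤ β) →
  (∀ {m} → InTauD (orient G oG ⊗ orient (K1nl n) oK) m → m ∈ ys) →
  length xs * (3 + n) ≤ length ys
lifted-count G n oG oK α β gap sum-bound 3≤α α≤β xs ys xs-unique xs-valences ys-τ =
  count-family ys value value-injective value-in-ys
  where
  open StarProduct G n oG oK
  c = α ∸ 3
  b = β ∸ 3
  α≡3+c : α ≡ 3 + c
  α≡3+c = sym (m+[n∸m]≡n 3≤α)
  β≡3+b : β ≡ 3 + b
  β≡3+b = sym (m+[n∸m]≡n (≤-trans 3≤α α≤β))
  open Separation N n c b
    (subst₂ (λ a b′ → b′ + (N + 2) * n < a + a * n) α≡3+c β≡3+b gap)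
    (subst₂ (λ a b′ → a + b′ ≤ 3 * suc N) α≡3+c β≡3+b sum-bound)

  spec : ∀ i → IsMagicValence G (lookup xs i) × α ≤ lookup xs i × lookup xs i ≤ β
  spec i = xs-valences (∈-lookup i)
  excess : Fin (length xs) → ℕ
  excess i = lookup xs i ∸ 3
  excess-form : ∀ i → lookup xs i ≡ 3 + excess i
  excess-form i = sym (m+[n∸m]≡n (≤-trans 3≤α (proj₁ (proj₂ (spec i)))))
  c≤excess : ∀ i → c ≤ excess i
  c≤excess i = ∸-monoˡ-≤ 3 (proj₁ (proj₂ (spec i)))
  excess≤b : ∀ i → excess i ≤ b
  excess≤b i = ∸-monoˡ-≤ 3 (proj₂ (proj₂ (spec i)))

  value : Fin (length xs) → Fin (3 + n) → ℕ
  value i j = 3 + liftedExcess N n (excess i) j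

  value-injective : ∀ {i j i′ j′} → value i j ≡ value i′ j′ → i ≡ i′ × j ≡ j′
  value-injective {i} {j} {i′} {j′} eq =
    let r≡r′ , j≡j′ = lifted-injective (c≤excess i) (excess≤b i) (c≤excess i′) (excess≤b i′) j j′
                        (+-cancelˡ-≡ 3 _ _ eq)
    in lookup-injective xs xs-unique (trans (excess-form i) (trans (cong (_+_ 3) r≡r′) (sym (excess-form i′))))
       , j≡j′

  value-in-ys : ∀ i j → value i j ∈ ys
  value-in-ys i j = ys-τ (valence-in-τ H (value i j)
    (lifted-valence (subst (IsMagicValence G) (excess-form i) (proj₁ (spec i))) j))

theorem2p3 : (G : Graph) (n : ℕ) → 1 ≤ n → EdgeMagic G
    → (oG : Fin (Graph.q G) → Bool) (oK : Fin (suc n) → Bool)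
    → (α β : ℕ) → IsMinValence G α → IsMaxValence G β
    → (+ β - + α) <ℤ ((+ α - + (Graph.p G + Graph.q G + 2)) *ℤ + n)
    → (k k′ : ℕ) → HasSize (InTau G) k
    → HasSize (InTauD (orient G oG ⊗ orient (K1nl n) oK)) k′
    → (n + 3) * k ≤ k′
theorem2p3 G n _ _ oG oK α β α-min β-max gapℤ k k′ (xs , xs-unique , refl , xs-τ) (ys , _ , refl , ys-τ) =
  subst (_≤ length ys) (reorder (length xs) n)
    (lifted-count G n oG oK α β gap sum-bound 3≤α α≤β xs ys xs-unique xs-valences (λ {m} → proj₁ (ys-τ m)))
  where
  N = Graph.p G + Graph.q G
  gap : β + (N + 2) * n < α + α * n
  gap = gap-in-ℕ α β (N + 2) n gapℤ
  α≤β : α ≤ β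
  α≤β = proj₂ β-max α (proj₁ α-min)
  3≤α : 3 ≤ α
  3≤α = ≤-trans (s≤s (m≤n+m 2 N)) (gap-lower-bound gap α≤β)
  sum-bound : α + β ≤ 3 * suc N
  sum-bound = extreme-valences-sum G α β (≤-trans (s≤s z≤n) 3≤α) α-min β-max
  xs-valences : ∀ {m} → m ∈ xs → IsMagicValence G m × α ≤ m × m ≤ β
  xs-valences {m} m∈xs = let valence = proj₂ (proj₂ (xs-τ m) m∈xs)
                         in valence , proj₂ α-min m valence , proj₂ β-max m valence
  reorder : ∀ l n → l * (3 + n) ≡ (n + 3) * l
  reorder = solve-∀
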